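{- There exist $3$-way $4$-homogeneous $(9,3,2)$, $(18,3,2)$, $(21,3,2)$ and $(33,3,2)$ Steiner trades of volume $12$, $24$, $28$ and $44$, respectively.
   Context: Let $V$ be a finite set with $v$ elements and let $t<k<v$ be positive integers. A $\mu$-way $(v,k,t)$ trade $T=\{T_1,\dots,T_\mu\}$ of volume $m$ consists of $\mu$ pairwise disjoint collections $T_1,\dots,T_\mu$, each of $m$ blocks ($k$-subsets of $V$), such that every $t$-subset of $V$ is contained in the same number of blocks in each $T_i$. The foundation $\mathrm{found}(T)$ is the set of elements covered by the blocks. It is a Steiner trade if every $t$-subset of $\mathrm{found}(T)$ is in at most one block of each $T_i$, and $d$-homogeneous if every element of $V$ lies in exactly $d$ blocks of each $T_i$. -}

module Defs where

open import Data.Nat using (ℕ; _<_; _≤_)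
open import Data.Fin using (Fin)
open import Data.Fin.Subset using (Subset; _⊆_; _∈_; ∣_∣; ⋃)
open import Data.Fin.Subset.Properties using (_⊆?_; _∈?_)
open import Data.List using (List; length; filter; concatMap; allFin)
open import Data.List.Relation.Unary.Unique.Propositional using (Unique)
open import Data.List.Membership.Propositional using () renaming (_∈_ to _∈ˡ_)
open import Data.Product using (_×_)
open import Relation.Binary.PropositionalEquality using (_≡_; _≢_)
open import Relation.Nullary using (¬_)

-- The point set V is Fin v.  A block is a subset of V (of size k).
-- A collection of blocks is a duplicate-free list of subsets (i.e. a finite set of blocks).

count : ∀ {v} → Subset v → List (Subset v) → ℕ
count S Bs = length (filter (λ B → S ⊆? B) Bs)

deg : ∀ {v} → Fin v → List (Subset v) → ℕ
deg x Bs = length (filter (λ B → x ∈? B) Bs)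

found : ∀ {v μ} → (Fin μ → List (Subset v)) → Subset v
found {μ = μ} T = ⋃ (concatMap T (allFin μ))

record IsTrade (μ v k t m : ℕ) (T : Fin μ → List (Subset v)) : Set where
  field
    t<k           : t < k
    k<v           : k < v
    volume        : ∀ i → length (T i) ≡ m
    noRepeat      : ∀ i → Unique (T i)
    blockSize     : ∀ i B → B ∈ˡ T i → ∣ B ∣ ≡ k
    disjoint      : ∀ i j → i ≢ j → ∀ B → B ∈ˡ T i → ¬ (B ∈ˡ T j)
    balanced      : ∀ i j (S : Subset v) → ∣ S ∣ ≡ t → count S (T i) ≡ count S (T j)

IsSteiner : ∀ {μ v} (t : ℕ) → (Fin μ → List (Subset v)) → Set
IsSteiner {μ} {v} t T = ∀ i (S : Subset v) → ∣ S ∣ ≡ t → S ⊆ found T → count S (T i) ≤ 1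

IsHomogeneous : ∀ {μ v} (d : ℕ) → (Fin μ → List (Subset v)) → Set
IsHomogeneous {μ} {v} d T = ∀ i (x : Fin v) → deg x (T i) ≡ d

SteinerTradeExists : (μ d v k t m : ℕ) → Set
SteinerTradeExists μ d v k t m =
  Data.Product.Σ (Fin μ → List (Subset v)) λ T →
    IsTrade μ v k t m T × IsSteiner t T × IsHomogeneous d T

-- Putting two trades on disjoint point sets side by side, piece by piece, is again a
-- trade: a t-subset meeting both point sets lies in no block, and any other t-subset sees
-- only one of the two summands.  Homogeneity and the packing property (every t-subset in
-- at most one block of each piece) survive as well.  The trades on 18, 21 and 33 points
-- are therefore the sums 9 + 9, 9 + 12 and 9 + 12 + 12 of a 3-way 4-homogeneous (9,3,2)
-- trade of volume 12 and a (12,3,2) one of volume 16, both checked by exhaustive computation.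
module Submission where

open import Defs
open import Data.Bool using (_∨_)
import Data.Bool as Bool
open import Data.Fin as Fin using (Fin; toℕ; _↑ˡ_; _↑ʳ_)
open import Data.Fin.Patterns using (0F; 1F; 2F)
import Data.Fin.Properties as Fin
open import Data.Fin.Subset using (Subset; inside; outside; ⊥; _⊆_; _∈_; _∉_; ∣_∣)
open import Data.Fin.Subset.Properties
  using (_⊆?_; _∈?_; drop-∷-⊆; out⊆; in⊆in; ⊥⊆; ∉⊥; ∣⊥∣≡0; p⊆q⇒∣p∣≤∣q∣)
open import Data.List as List using (List; []; _∷_; [_]; map; length; filter)
open import Data.List.Properties using (filter-++; filter-reject; length-++; length-map)
open import Data.List.Membership.Propositional using () renaming (_∈_ to _∈ˡ_)
open import Data.List.Membership.Propositional.Properties using (∈-map⁺; ∈-map⁻; ∈-++⁺ˡ; ∈-++⁺ʳ; ∈-++⁻)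
import Data.List.Membership.DecPropositional as DecMembership
open import Data.List.Relation.Binary.Disjoint.Propositional using (Disjoint)
open import Data.List.Relation.Unary.Any using (here)
import Data.List.Relation.Unary.All as All
import Data.List.Relation.Unary.Unique.DecPropositional as DecUnique
open import Data.List.Relation.Unary.Unique.Propositional using (Unique)
import Data.List.Relation.Unary.Unique.Propositional.Properties as Unique
open import Data.Nat using (ℕ; zero; suc; z≤n; _+_; _≤_; _≡ᵇ_; _≟_; _≤?_; _<?_)
open import Data.Nat.Properties using (+-identityʳ; m≤m+n; <-≤-trans; m<n⇒n≢0; n≤0⇒n≡0; module ≤-Reasoning)
open import Data.Product using (_×_; _,_; ∃-syntax)
open import Data.Sum using (_⊎_; inj₁; inj₂)
open import Data.Vec using ([]; _∷_; _++_; here; there; tabulate; splitAt)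
open import Data.Vec.Properties using (≡-dec; ++-injectiveˡ; ++-injectiveʳ)
open import Function using (_∘′_)
open import Function.Bundles using (_⇔_; mk⇔; Equivalence)
open import Relation.Binary.PropositionalEquality using (_≡_; _≢_; refl; sym; trans; cong; cong₂; subst; module ≡-Reasoning)
open import Relation.Nullary using (¬_; Dec; yes; no; ¬?; contradiction)
open import Relation.Nullary.Decidable using (map′; _×-dec_; _→-dec_; from-yes)
open import Level using (0ℓ)
open import Relation.Unary using (Pred; Decidable)

private
  variable
    μ d k t m n v w : ℕ

module _ {A B : Set} {P : Pred B 0ℓ} {Q : Pred A 0ℓ} (P? : Decidable P) (Q? : Decidable Q) where

  length-filter-map : (f : A → B) → (∀ x → P (f x) ⇔ Q x) →
                      ∀ xs → length (filter P? (map f xs)) ≡ length (filter Q? xs)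
  length-filter-map f P⇔Q [] = refl
  length-filter-map f P⇔Q (x ∷ xs) with P? (f x) | Q? x
  ... | yes _  | yes _  = cong suc (length-filter-map f P⇔Q xs)
  ... | no _   | no _   = length-filter-map f P⇔Q xs
  ... | yes p  | no ¬q  = contradiction (Equivalence.to (P⇔Q x) p) ¬q
  ... | no ¬p  | yes q  = contradiction (Equivalence.from (P⇔Q x) q) ¬p

module _ {A B : Set} {P : Pred B 0ℓ} (P? : Decidable P) where

  length-filter-map-none : (f : A → B) → (∀ x → ¬ P (f x)) →
                           ∀ xs → length (filter P? (map f xs)) ≡ 0
  length-filter-map-none f ¬P [] = refl
  length-filter-map-none f ¬P (x ∷ xs) =
    trans (cong length (filter-reject P? (¬P x))) (length-filter-map-none f ¬P xs)

length-filter-++ : {A : Set} {P : Pred A 0ℓ} (P? : Decidable P) (xs ys : List A) →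
                   length (filter P? (xs List.++ ys)) ≡ length (filter P? xs) + length (filter P? ys)
length-filter-++ P? xs ys = trans (cong length (filter-++ P? xs ys)) (length-++ (filter P? xs))

++-⊆⁺ : {p r : Subset v} {q s : Subset w} → p ⊆ r → q ⊆ s → p ++ q ⊆ r ++ s
++-⊆⁺ {p = []}          {[]}    _   q⊆s = q⊆s
++-⊆⁺ {p = outside ∷ p} {_ ∷ r} p⊆r q⊆s = out⊆ (++-⊆⁺ (drop-∷-⊆ p⊆r) q⊆s)
++-⊆⁺ {p = inside ∷ p}  {_ ∷ r} p⊆r q⊆s with p⊆r here
... | here = in⊆in (++-⊆⁺ (drop-∷-⊆ p⊆r) q⊆s)

++-⊆⁻ˡ : {p r : Subset v} {q s : Subset w} → p ++ q ⊆ r ++ s → p ⊆ r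
++-⊆⁻ˡ {p = []}          {[]}    _ = ⊥⊆
++-⊆⁻ˡ {p = outside ∷ p} {_ ∷ r} h = out⊆ (++-⊆⁻ˡ (drop-∷-⊆ h))
++-⊆⁻ˡ {p = inside ∷ p}  {_ ∷ r} h with h here
... | here = in⊆in (++-⊆⁻ˡ (drop-∷-⊆ h))

++-⊆⁻ʳ : (p r : Subset v) {q s : Subset w} → p ++ q ⊆ r ++ s → q ⊆ s
++-⊆⁻ʳ []      []      h = h
++-⊆⁻ʳ (_ ∷ p) (_ ∷ r) h = ++-⊆⁻ʳ p r (drop-∷-⊆ h)

↑ˡ-∈-++⁺ : {p : Subset v} {q : Subset w} {i : Fin v} → i ∈ p → (i ↑ˡ w) ∈ p ++ q
↑ˡ-∈-++⁺ here      = here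
↑ˡ-∈-++⁺ (there h) = there (↑ˡ-∈-++⁺ h)

↑ˡ-∈-++⁻ : {p : Subset v} {q : Subset w} {i : Fin v} → (i ↑ˡ w) ∈ p ++ q → i ∈ p
↑ˡ-∈-++⁻ {p = _ ∷ _} {i = Fin.zero}  here      = here
↑ˡ-∈-++⁻ {p = _ ∷ _} {i = Fin.suc i} (there h) = there (↑ˡ-∈-++⁻ h)

↑ʳ-∈-++⁺ : (p : Subset v) {q : Subset w} {j : Fin w} → j ∈ q → (v ↑ʳ j) ∈ p ++ q
↑ʳ-∈-++⁺ []      h = h
↑ʳ-∈-++⁺ (_ ∷ p) h = there (↑ʳ-∈-++⁺ p h)

↑ʳ-∈-++⁻ : (p : Subset v) {q : Subset w} {j : Fin w} → (v ↑ʳ j) ∈ p ++ q → j ∈ q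
↑ʳ-∈-++⁻ []      h         = h
↑ʳ-∈-++⁻ (_ ∷ p) (there h) = ↑ʳ-∈-++⁻ p h

∣p++q∣≡∣p∣+∣q∣ : (p : Subset v) (q : Subset w) → ∣ p ++ q ∣ ≡ ∣ p ∣ + ∣ q ∣
∣p++q∣≡∣p∣+∣q∣ []            q = refl
∣p++q∣≡∣p∣+∣q∣ (inside ∷ p)  q = cong suc (∣p++q∣≡∣p∣+∣q∣ p q)
∣p++q∣≡∣p∣+∣q∣ (outside ∷ p) q = ∣p++q∣≡∣p∣+∣q∣ p q

p⊆⊥⇒∣p∣≡0 : {p : Subset n} → p ⊆ ⊥ → ∣ p ∣ ≡ 0
p⊆⊥⇒∣p∣≡0 {n} {p} p⊆⊥ = n≤0⇒n≡0 (subst (∣ p ∣ ≤_) (∣⊥∣≡0 n) (p⊆q⇒∣p∣≤∣q∣ p⊆⊥))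

∣p++q∣≡∣p∣ : (p : Subset v) {q : Subset w} → q ⊆ ⊥ → ∣ p ++ q ∣ ≡ ∣ p ∣
∣p++q∣≡∣p∣ p {q} q⊆⊥ = begin
  ∣ p ++ q ∣     ≡⟨ ∣p++q∣≡∣p∣+∣q∣ p q ⟩
  ∣ p ∣ + ∣ q ∣  ≡⟨ cong (∣ p ∣ +_) (p⊆⊥⇒∣p∣≡0 q⊆⊥) ⟩
  ∣ p ∣ + 0      ≡⟨ +-identityʳ ∣ p ∣ ⟩
  ∣ p ∣          ∎
  where open ≡-Reasoning

∣p++q∣≡∣q∣ : (p : Subset v) {q : Subset w} → p ⊆ ⊥ → ∣ p ++ q ∣ ≡ ∣ q ∣
∣p++q∣≡∣q∣ p {q} p⊆⊥ = trans (∣p++q∣≡∣p∣+∣q∣ p q) (cong (_+ ∣ q ∣) (p⊆⊥⇒∣p∣≡0 p⊆⊥))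

p++⊥≢⊥++q : (p : Subset v) (q : Subset w) → ∣ p ∣ ≢ 0 → p ++ ⊥ ≢ ⊥ ++ q
p++⊥≢⊥++q {v} p _ ∣p∣≢0 eq = ∣p∣≢0 (trans (cong ∣_∣ (++-injectiveˡ p ⊥ eq)) (∣⊥∣≡0 v))

module _ {S₁ : Subset v} {S₂ : Subset w} where

  count-map-++ˡ : {C : Subset w} → S₂ ⊆ C → (Bs : List (Subset v)) →
                  count (S₁ ++ S₂) (map (_++ C) Bs) ≡ count S₁ Bs
  count-map-++ˡ S₂⊆C = length-filter-map (S₁ ++ S₂ ⊆?_) (S₁ ⊆?_) (_++ _)
    λ _ → mk⇔ ++-⊆⁻ˡ (λ S₁⊆B → ++-⊆⁺ S₁⊆B S₂⊆C)

  count-map-++ˡ-⊈ : {C : Subset w} → ¬ S₂ ⊆ C → (Bs : List (Subset v)) →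
                    count (S₁ ++ S₂) (map (_++ C) Bs) ≡ 0
  count-map-++ˡ-⊈ S₂⊈C = length-filter-map-none (S₁ ++ S₂ ⊆?_) (_++ _)
    λ B → S₂⊈C ∘′ ++-⊆⁻ʳ S₁ B

  count-map-++ʳ : {C : Subset v} → S₁ ⊆ C → (Bs : List (Subset w)) →
                  count (S₁ ++ S₂) (map (C ++_) Bs) ≡ count S₂ Bs
  count-map-++ʳ {C} S₁⊆C = length-filter-map (S₁ ++ S₂ ⊆?_) (S₂ ⊆?_) (C ++_)
    λ _ → mk⇔ (++-⊆⁻ʳ S₁ C) (++-⊆⁺ S₁⊆C)

  count-map-++ʳ-⊈ : {C : Subset v} → ¬ S₁ ⊆ C → (Bs : List (Subset w)) →
                    count (S₁ ++ S₂) (map (C ++_) Bs) ≡ 0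
  count-map-++ʳ-⊈ S₁⊈C = length-filter-map-none (S₁ ++ S₂ ⊆?_) (_ ++_) λ _ → S₁⊈C ∘′ ++-⊆⁻ˡ

deg-map-++ˡ : (i : Fin v) {C : Subset w} (Bs : List (Subset v)) →
              deg (i ↑ˡ w) (map (_++ C) Bs) ≡ deg i Bs
deg-map-++ˡ i = length-filter-map (i ↑ˡ _ ∈?_) (i ∈?_) (_++ _) λ _ → mk⇔ ↑ˡ-∈-++⁻ ↑ˡ-∈-++⁺

deg-map-++ˡ-∉ : {j : Fin w} {C : Subset w} → j ∉ C → (Bs : List (Subset v)) →
                deg (v ↑ʳ j) (map (_++ C) Bs) ≡ 0
deg-map-++ˡ-∉ {j = j} j∉C = length-filter-map-none (_ ↑ʳ j ∈?_) (_++ _) λ B → j∉C ∘′ ↑ʳ-∈-++⁻ B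

deg-map-++ʳ : (j : Fin w) {C : Subset v} (Bs : List (Subset w)) →
              deg (v ↑ʳ j) (map (C ++_) Bs) ≡ deg j Bs
deg-map-++ʳ j {C} = length-filter-map (_ ↑ʳ j ∈?_) (j ∈?_) (C ++_) λ _ → mk⇔ (↑ʳ-∈-++⁻ C) (↑ʳ-∈-++⁺ C)

deg-map-++ʳ-∉ : {i : Fin v} {C : Subset v} → i ∉ C → (Bs : List (Subset w)) →
                deg (i ↑ˡ w) (map (C ++_) Bs) ≡ 0
deg-map-++ʳ-∉ {i = i} i∉C = length-filter-map-none (i ↑ˡ _ ∈?_) (_ ++_) λ _ → i∉C ∘′ ↑ˡ-∈-++⁻

-- Unlike IsSteiner, this constrains every t-subset, not only those inside the foundation,
-- which makes it stable under ⊕ without any reasoning about foundations.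
IsPacking : {μ v : ℕ} → ℕ → (Fin μ → List (Subset v)) → Set
IsPacking t T = ∀ i S → ∣ S ∣ ≡ t → count S (T i) ≤ 1

IsPacking⇒IsSteiner : {T : Fin μ → List (Subset v)} → IsPacking t T → IsSteiner t T
IsPacking⇒IsSteiner packing i S ∣S∣≡t _ = packing i S ∣S∣≡t

_⊕_ : (Fin μ → List (Subset v)) → (Fin μ → List (Subset w)) → Fin μ → List (Subset (v + w))
(T ⊕ U) i = map (_++ ⊥) (T i) List.++ map (⊥ ++_) (U i)

module _ {T : Fin μ → List (Subset v)} {U : Fin μ → List (Subset w)} where

  ∈-⊕⁻ : ∀ {i B} → B ∈ˡ (T ⊕ U) i →
         (∃[ B′ ] B′ ∈ˡ T i × B ≡ B′ ++ ⊥) ⊎ (∃[ B′ ] B′ ∈ˡ U i × B ≡ ⊥ ++ B′)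
  ∈-⊕⁻ {i} B∈ with ∈-++⁻ (map (_++ ⊥) (T i)) B∈
  ... | inj₁ B∈ˡ = inj₁ (∈-map⁻ (_++ ⊥) B∈ˡ)
  ... | inj₂ B∈ʳ = inj₂ (∈-map⁻ (⊥ ++_) B∈ʳ)

  count-⊕ : ∀ i S →
            count S ((T ⊕ U) i) ≡ count S (map (_++ ⊥) (T i)) + count S (map (⊥ ++_) (U i))
  count-⊕ i S = length-filter-++ (S ⊆?_) (map (_++ ⊥) (T i)) (map (⊥ ++_) (U i))

  deg-⊕ : ∀ i x →
          deg x ((T ⊕ U) i) ≡ deg x (map (_++ ⊥) (T i)) + deg x (map (⊥ ++_) (U i))
  deg-⊕ i x = length-filter-++ (x ∈?_) (map (_++ ⊥) (T i)) (map (⊥ ++_) (U i))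

  module _ (τ : IsTrade μ v k t m T) (υ : IsTrade μ w k t n U) where
    private
      module τ = IsTrade τ
      module υ = IsTrade υ

      k≢0 : k ≢ 0
      k≢0 = m<n⇒n≢0 τ.t<k

      sides-disjoint : ∀ {i j B₁ B₂} → B₁ ∈ˡ T i → B₂ ∈ˡ U j → B₁ ++ ⊥ ≢ ⊥ ++ B₂
      sides-disjoint {i} {B₁ = B₁} {B₂} B₁∈ _ =
        p++⊥≢⊥++q B₁ B₂ λ ∣B₁∣≡0 → k≢0 (trans (sym (τ.blockSize i B₁ B₁∈)) ∣B₁∣≡0)

      blockSize : ∀ i B → B ∈ˡ (T ⊕ U) i → ∣ B ∣ ≡ k
      blockSize i B B∈ with ∈-⊕⁻ B∈
      ... | inj₁ (B′ , B′∈ , refl) = trans (∣p++q∣≡∣p∣ B′ ⊥⊆) (τ.blockSize i B′ B′∈)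
      ... | inj₂ (B′ , B′∈ , refl) = trans (∣p++q∣≡∣q∣ (⊥ {n = v}) ⊥⊆) (υ.blockSize i B′ B′∈)

      disjoint : ∀ i j → i ≢ j → ∀ B → B ∈ˡ (T ⊕ U) i → ¬ (B ∈ˡ (T ⊕ U) j)
      disjoint i j i≢j B B∈i B∈j with ∈-⊕⁻ B∈i | ∈-⊕⁻ B∈j
      ... | inj₁ (B₁ , B₁∈ , refl) | inj₁ (B₂ , B₂∈ , eq) =
        τ.disjoint i j i≢j B₁ B₁∈ (subst (_∈ˡ T j) (sym (++-injectiveˡ B₁ B₂ eq)) B₂∈)
      ... | inj₂ (B₁ , B₁∈ , refl) | inj₂ (B₂ , B₂∈ , eq) =
        υ.disjoint i j i≢j B₁ B₁∈ (subst (_∈ˡ U j) (sym (++-injectiveʳ ⊥ ⊥ eq)) B₂∈)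
      ... | inj₁ (B₁ , B₁∈ , refl) | inj₂ (B₂ , B₂∈ , eq) = sides-disjoint B₁∈ B₂∈ eq
      ... | inj₂ (B₁ , B₁∈ , refl) | inj₁ (B₂ , B₂∈ , eq) = sides-disjoint B₂∈ B₁∈ (sym eq)

      noRepeat : ∀ i → Unique ((T ⊕ U) i)
      noRepeat i = Unique.++⁺ (Unique.map⁺ (++-injectiveˡ _ _) (τ.noRepeat i))
                              (Unique.map⁺ (++-injectiveʳ ⊥ ⊥) (υ.noRepeat i))
                              sides
        where
          sides : Disjoint (map (_++ ⊥) (T i)) (map (⊥ ++_) (U i))
          sides (B∈ˡ , B∈ʳ) with ∈-map⁻ _ B∈ˡ | ∈-map⁻ _ B∈ʳ
          ... | _ , B₁∈ , refl | _ , B₂∈ , eq = sides-disjoint B₁∈ B₂∈ eq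

      balanced : ∀ i j S → ∣ S ∣ ≡ t → count S ((T ⊕ U) i) ≡ count S ((T ⊕ U) j)
      balanced i j S ∣S∣≡t with splitAt v S
      ... | S₁ , S₂ , refl =
        trans (count-⊕ i _) (trans (cong₂ _+_ left right) (sym (count-⊕ j _)))
        where
          left : count (S₁ ++ S₂) (map (_++ ⊥) (T i)) ≡ count (S₁ ++ S₂) (map (_++ ⊥) (T j))
          left with S₂ ⊆? ⊥
          ... | yes S₂⊆⊥ = begin
            count (S₁ ++ S₂) (map (_++ ⊥) (T i))  ≡⟨ count-map-++ˡ S₂⊆⊥ (T i) ⟩
            count S₁ (T i)                        ≡⟨ τ.balanced i j S₁ (trans (sym (∣p++q∣≡∣p∣ S₁ S₂⊆⊥)) ∣S∣≡t) ⟩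
            count S₁ (T j)                        ≡⟨ count-map-++ˡ S₂⊆⊥ (T j) ⟨
            count (S₁ ++ S₂) (map (_++ ⊥) (T j))  ∎
            where open ≡-Reasoning
          ... | no S₂⊈⊥ = trans (count-map-++ˡ-⊈ S₂⊈⊥ (T i)) (sym (count-map-++ˡ-⊈ S₂⊈⊥ (T j)))

          right : count (S₁ ++ S₂) (map (⊥ ++_) (U i)) ≡ count (S₁ ++ S₂) (map (⊥ ++_) (U j))
          right with S₁ ⊆? ⊥
          ... | yes S₁⊆⊥ = begin
            count (S₁ ++ S₂) (map (⊥ ++_) (U i))  ≡⟨ count-map-++ʳ S₁⊆⊥ (U i) ⟩
            count S₂ (U i)                        ≡⟨ υ.balanced i j S₂ (trans (sym (∣p++q∣≡∣q∣ S₁ S₁⊆⊥)) ∣S∣≡t) ⟩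
            count S₂ (U j)                        ≡⟨ count-map-++ʳ S₁⊆⊥ (U j) ⟨
            count (S₁ ++ S₂) (map (⊥ ++_) (U j))  ∎
            where open ≡-Reasoning
          ... | no S₁⊈⊥ = trans (count-map-++ʳ-⊈ S₁⊈⊥ (U i)) (sym (count-map-++ʳ-⊈ S₁⊈⊥ (U j)))

    ⊕-isTrade : IsTrade μ (v + w) k t (m + n) (T ⊕ U)
    ⊕-isTrade = record
      { t<k       = τ.t<k
      ; k<v       = <-≤-trans τ.k<v (m≤m+n v w)
      ; volume    = λ i → trans (length-++ (map (_++ ⊥) (T i)))
                                (cong₂ _+_ (trans (length-map _ (T i)) (τ.volume i))
                                           (trans (length-map _ (U i)) (υ.volume i)))
      ; noRepeat  = noRepeat
      ; blockSize = blockSize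
      ; disjoint  = disjoint
      ; balanced  = balanced
      }

  ⊕-isPacking : IsPacking (suc t) T → IsPacking (suc t) U → IsPacking (suc t) (T ⊕ U)
  ⊕-isPacking packingᵀ packingᵁ i S ∣S∣≡1+t with splitAt v S
  ... | S₁ , S₂ , refl with S₁ ⊆? ⊥ | S₂ ⊆? ⊥
  ... | yes S₁⊆⊥ | yes S₂⊆⊥ =
    contradiction (trans (sym ∣S∣≡1+t) (trans (∣p++q∣≡∣p∣ S₁ S₂⊆⊥) (p⊆⊥⇒∣p∣≡0 S₁⊆⊥))) λ ()
  ... | no S₁⊈⊥ | yes S₂⊆⊥ = begin
    count (S₁ ++ S₂) ((T ⊕ U) i)                                          ≡⟨ count-⊕ i _ ⟩
    count (S₁ ++ S₂) (map (_++ ⊥) (T i)) + count (S₁ ++ S₂) (map (⊥ ++_) (U i))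
      ≡⟨ cong₂ _+_ (count-map-++ˡ S₂⊆⊥ (T i)) (count-map-++ʳ-⊈ S₁⊈⊥ (U i)) ⟩
    count S₁ (T i) + 0                                                    ≡⟨ +-identityʳ _ ⟩
    count S₁ (T i)                        ≤⟨ packingᵀ i S₁ (trans (sym (∣p++q∣≡∣p∣ S₁ S₂⊆⊥)) ∣S∣≡1+t) ⟩
    1                                                                     ∎
    where open ≤-Reasoning
  ... | yes S₁⊆⊥ | no S₂⊈⊥ = begin
    count (S₁ ++ S₂) ((T ⊕ U) i)                                          ≡⟨ count-⊕ i _ ⟩
    count (S₁ ++ S₂) (map (_++ ⊥) (T i)) + count (S₁ ++ S₂) (map (⊥ ++_) (U i))
      ≡⟨ cong₂ _+_ (count-map-++ˡ-⊈ S₂⊈⊥ (T i)) (count-map-++ʳ S₁⊆⊥ (U i)) ⟩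
    count S₂ (U i)                        ≤⟨ packingᵁ i S₂ (trans (sym (∣p++q∣≡∣q∣ S₁ S₁⊆⊥)) ∣S∣≡1+t) ⟩
    1                                                                     ∎
    where open ≤-Reasoning
  ... | no S₁⊈⊥ | no S₂⊈⊥ = begin
    count (S₁ ++ S₂) ((T ⊕ U) i)                                          ≡⟨ count-⊕ i _ ⟩
    count (S₁ ++ S₂) (map (_++ ⊥) (T i)) + count (S₁ ++ S₂) (map (⊥ ++_) (U i))
      ≡⟨ cong₂ _+_ (count-map-++ˡ-⊈ S₂⊈⊥ (T i)) (count-map-++ʳ-⊈ S₁⊈⊥ (U i)) ⟩
    0                                                                     ≤⟨ z≤n ⟩
    1                                                                     ∎
    where open ≤-Reasoning

  ⊕-isHomogeneous : IsHomogeneous d T → IsHomogeneous d U → IsHomogeneous d (T ⊕ U)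
  ⊕-isHomogeneous {d} homᵀ homᵁ i x =
    subst (λ y → deg y ((T ⊕ U) i) ≡ d) (Fin.join-splitAt v w x) (bySide (Fin.splitAt v x))
    where
      open ≡-Reasoning
      bySide : ∀ s → deg (Fin.join v w s) ((T ⊕ U) i) ≡ d
      bySide (inj₁ x) = begin
        deg (x ↑ˡ w) ((T ⊕ U) i)                                              ≡⟨ deg-⊕ i _ ⟩
        deg (x ↑ˡ w) (map (_++ ⊥) (T i)) + deg (x ↑ˡ w) (map (⊥ ++_) (U i))
          ≡⟨ cong₂ _+_ (deg-map-++ˡ x (T i)) (deg-map-++ʳ-∉ ∉⊥ (U i)) ⟩
        deg x (T i) + 0                                                       ≡⟨ +-identityʳ _ ⟩
        deg x (T i)                                                           ≡⟨ homᵀ i x ⟩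
        d                                                                     ∎
      bySide (inj₂ y) = begin
        deg (v ↑ʳ y) ((T ⊕ U) i)                                              ≡⟨ deg-⊕ i _ ⟩
        deg (v ↑ʳ y) (map (_++ ⊥) (T i)) + deg (v ↑ʳ y) (map (⊥ ++_) (U i))
          ≡⟨ cong₂ _+_ (deg-map-++ˡ-∉ ∉⊥ (T i)) (deg-map-++ʳ y (U i)) ⟩
        deg y (U i)                                                           ≡⟨ homᵁ i y ⟩
        d                                                                     ∎

record PackingTrade (μ d v k t m : ℕ) : Set where
  field
    pieces        : Fin μ → List (Subset v)
    isTrade       : IsTrade μ v k t m pieces
    isPacking     : IsPacking t pieces
    isHomogeneous : IsHomogeneous d pieces

  steinerTradeExists : SteinerTradeExists μ d v k t m
  steinerTradeExists = pieces , isTrade , IsPacking⇒IsSteiner isPacking , isHomogeneous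

open PackingTrade

infixl 6 _⊕ₜ_

_⊕ₜ_ : PackingTrade μ d v k (suc t) m → PackingTrade μ d w k (suc t) n →
       PackingTrade μ d (v + w) k (suc t) (m + n)
τ ⊕ₜ υ = record
  { pieces        = pieces τ ⊕ pieces υ
  ; isTrade       = ⊕-isTrade (isTrade τ) (isTrade υ)
  ; isPacking     = ⊕-isPacking {T = pieces τ} {pieces υ} (isPacking τ) (isPacking υ)
  ; isHomogeneous = ⊕-isHomogeneous {T = pieces τ} {pieces υ} (isHomogeneous τ) (isHomogeneous υ)
  }

subsetsOfSize : (n k : ℕ) → List (Subset n)
subsetsOfSize zero    zero    = [ [] ]
subsetsOfSize zero    (suc k) = []
subsetsOfSize (suc n) zero    = map (outside ∷_) (subsetsOfSize n zero)
subsetsOfSize (suc n) (suc k) =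
  map (inside ∷_) (subsetsOfSize n k) List.++ map (outside ∷_) (subsetsOfSize n (suc k))

∈-subsetsOfSize⁺ : (S : Subset n) → S ∈ˡ subsetsOfSize n ∣ S ∣
∈-subsetsOfSize⁺ []            = here refl
∈-subsetsOfSize⁺ (inside ∷ S)  = ∈-++⁺ˡ (∈-map⁺ (inside ∷_) (∈-subsetsOfSize⁺ S))
∈-subsetsOfSize⁺ (outside ∷ S) with ∣ S ∣ | ∈-subsetsOfSize⁺ S
... | zero  | S∈ = ∈-map⁺ (outside ∷_) S∈
... | suc k | S∈ = ∈-++⁺ʳ (map (inside ∷_) (subsetsOfSize _ k)) (∈-map⁺ (outside ∷_) S∈)

∈-subsetsOfSize⁻ : {S : Subset n} → S ∈ˡ subsetsOfSize n k → ∣ S ∣ ≡ k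
∈-subsetsOfSize⁻ {zero}  {zero}  (here refl) = refl
∈-subsetsOfSize⁻ {suc n} {zero}  S∈ with ∈-map⁻ (outside ∷_) S∈
... | _ , S′∈ , refl = ∈-subsetsOfSize⁻ S′∈
∈-subsetsOfSize⁻ {suc n} {suc k} S∈ with ∈-++⁻ (map (inside ∷_) (subsetsOfSize n k)) S∈
... | inj₁ S∈ˡ with ∈-map⁻ (inside ∷_) S∈ˡ
...   | _ , S′∈ , refl = cong suc (∈-subsetsOfSize⁻ S′∈)
∈-subsetsOfSize⁻ {suc n} {suc k} S∈ | inj₂ S∈ʳ with ∈-map⁻ (outside ∷_) S∈ʳ
...   | _ , S′∈ , refl = ∈-subsetsOfSize⁻ S′∈

∀∈? : {A : Set} {P : Pred A 0ℓ} → Decidable P → (xs : List A) → Dec (∀ x → x ∈ˡ xs → P x)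
∀∈? P? xs = map′ (λ all _ → All.lookup all) (λ h → All.tabulate (h _)) (All.all? P? xs)

∀-ofSize? : {P : Pred (Subset n) 0ℓ} → Decidable P → Dec (∀ S → ∣ S ∣ ≡ k → P S)
∀-ofSize? {n} {k} P? = map′
  (λ h S ∣S∣≡k → h S (subst (λ k → S ∈ˡ subsetsOfSize n k) ∣S∣≡k (∈-subsetsOfSize⁺ S)))
  (λ h S S∈ → h S (∈-subsetsOfSize⁻ S∈))
  (∀∈? P? (subsetsOfSize n k))

module _ {μ v : ℕ} (T : Fin μ → List (Subset v)) where
  open DecMembership (≡-dec {n = v} Bool._≟_) using () renaming (_∈?_ to _∈ˡ?_)
  open DecUnique (≡-dec {n = v} Bool._≟_) using (unique?)

  isTrade? : ∀ k t m → Dec (IsTrade μ v k t m T)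
  isTrade? k t m = map′
    (λ (t<k , k<v , volume , noRepeat , blockSize , disjoint , balanced) → record
      { t<k = t<k ; k<v = k<v ; volume = volume ; noRepeat = noRepeat
      ; blockSize = blockSize ; disjoint = disjoint ; balanced = balanced })
    (λ τ → let open IsTrade τ in t<k , k<v , volume , noRepeat , blockSize , disjoint , balanced)
    (t <? k ×-dec k <? v ×-dec volume? ×-dec noRepeat? ×-dec blockSize? ×-dec disjoint? ×-dec balanced?)
    where
      volume? : Dec (∀ i → length (T i) ≡ m)
      volume? = Fin.all? λ i → length (T i) ≟ m
      noRepeat? : Dec (∀ i → Unique (T i))
      noRepeat? = Fin.all? λ i → unique? (T i)
      blockSize? : Dec (∀ i B → B ∈ˡ T i → ∣ B ∣ ≡ k)
      blockSize? = Fin.all? λ i → ∀∈? (λ B → ∣ B ∣ ≟ k) (T i)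
      disjoint? : Dec (∀ i j → i ≢ j → ∀ B → B ∈ˡ T i → ¬ (B ∈ˡ T j))
      disjoint? = Fin.all? λ i → Fin.all? λ j → ¬? (i Fin.≟ j) →-dec ∀∈? (λ B → ¬? (B ∈ˡ? T j)) (T i)
      balanced? : Dec (∀ i j (S : Subset v) → ∣ S ∣ ≡ t → count S (T i) ≡ count S (T j))
      balanced? = map′ (λ h i j S ∣S∣≡t → h S ∣S∣≡t i j) (λ h S ∣S∣≡t i j → h i j S ∣S∣≡t)
        (∀-ofSize? λ S → Fin.all? λ i → Fin.all? λ j → count S (T i) ≟ count S (T j))

  isPacking? : ∀ t → Dec (IsPacking t T)
  isPacking? t = map′ (λ h i S ∣S∣≡t → h S ∣S∣≡t i) (λ h S ∣S∣≡t i → h i S ∣S∣≡t)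
    (∀-ofSize? λ S → Fin.all? λ i → count S (T i) ≤? 1)

  isHomogeneous? : ∀ d → Dec (IsHomogeneous d T)
  isHomogeneous? d = Fin.all? λ i → Fin.all? λ x → deg x (T i) ≟ d

triple : ℕ → ℕ → ℕ → Subset n
triple a b c = tabulate λ x → (toℕ x ≡ᵇ a) ∨ (toℕ x ≡ᵇ b) ∨ (toℕ x ≡ᵇ c)

pieces₉ : Fin 3 → List (Subset 9)
pieces₉ 0F =
  triple 2 7 8 ∷ triple 2 3 4 ∷ triple 0 2 6 ∷ triple 1 2 5 ∷ triple 1 4 8 ∷ triple 4 5 6 ∷
  triple 0 4 7 ∷ triple 0 1 3 ∷ triple 0 5 8 ∷ triple 1 6 7 ∷ triple 3 5 7 ∷ triple 3 6 8 ∷ []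
pieces₉ 1F =
  triple 1 2 8 ∷ triple 2 3 5 ∷ triple 2 4 6 ∷ triple 0 2 7 ∷ triple 0 4 5 ∷ triple 1 3 4 ∷
  triple 4 7 8 ∷ triple 5 6 8 ∷ triple 3 6 7 ∷ triple 1 5 7 ∷ triple 0 1 6 ∷ triple 0 3 8 ∷ []
pieces₉ 2F =
  triple 2 3 8 ∷ triple 2 5 6 ∷ triple 0 2 4 ∷ triple 1 2 7 ∷ triple 4 6 8 ∷ triple 1 4 5 ∷
  triple 3 4 7 ∷ triple 0 1 8 ∷ triple 5 7 8 ∷ triple 0 3 5 ∷ triple 0 6 7 ∷ triple 1 3 6 ∷ []

pieces₁₂ : Fin 3 → List (Subset 12)
pieces₁₂ 0F =
  triple 2 4 6 ∷ triple 1 2 3 ∷ triple 2 9 10 ∷ triple 0 2 7 ∷ triple 4 5 9 ∷ triple 7 9 11 ∷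
  triple 1 8 9 ∷ triple 0 1 5 ∷ triple 1 6 11 ∷ triple 3 7 8 ∷ triple 3 4 11 ∷ triple 0 10 11 ∷
  triple 0 4 8 ∷ triple 6 8 10 ∷ triple 5 6 7 ∷ triple 3 5 10 ∷ []
pieces₁₂ 1F =
  triple 4 6 8 ∷ triple 0 4 5 ∷ triple 2 3 4 ∷ triple 4 9 11 ∷ triple 0 7 8 ∷ triple 0 1 11 ∷
  triple 0 2 10 ∷ triple 1 3 8 ∷ triple 8 9 10 ∷ triple 3 5 7 ∷ triple 2 7 9 ∷ triple 1 2 6 ∷
  triple 1 5 9 ∷ triple 5 6 10 ∷ triple 3 10 11 ∷ triple 6 7 11 ∷ []
pieces₁₂ 2F =
  triple 4 6 11 ∷ triple 3 4 5 ∷ triple 0 7 11 ∷ triple 0 5 10 ∷ triple 9 10 11 ∷ triple 5 7 9 ∷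
  triple 6 7 8 ∷ triple 2 6 10 ∷ triple 2 3 7 ∷ triple 0 2 4 ∷ triple 4 8 9 ∷ triple 1 2 9 ∷
  triple 3 8 10 ∷ triple 1 5 6 ∷ triple 0 1 8 ∷ triple 1 3 11 ∷ []

trade₉ : PackingTrade 3 4 9 3 2 12
trade₉ = record
  { pieces        = pieces₉
  ; isTrade       = from-yes (isTrade? pieces₉ 3 2 12)
  ; isPacking     = from-yes (isPacking? pieces₉ 2)
  ; isHomogeneous = from-yes (isHomogeneous? pieces₉ 4)
  }

trade₁₂ : PackingTrade 3 4 12 3 2 16
trade₁₂ = record
  { pieces        = pieces₁₂
  ; isTrade       = from-yes (isTrade? pieces₁₂ 3 2 16)
  ; isPacking     = from-yes (isPacking? pieces₁₂ 2)
  ; isHomogeneous = from-yes (isHomogeneous? pieces₁₂ 4)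
  }

proposition3p1 : SteinerTradeExists 3 4 9 3 2 12
                 × SteinerTradeExists 3 4 18 3 2 24
                 × SteinerTradeExists 3 4 21 3 2 28
                 × SteinerTradeExists 3 4 33 3 2 44
proposition3p1 = steinerTradeExists trade₉
               , steinerTradeExists (trade₉ ⊕ₜ trade₉)
               , steinerTradeExists (trade₉ ⊕ₜ trade₁₂)
               , steinerTradeExists (trade₉ ⊕ₜ trade₁₂ ⊕ₜ trade₁₂)
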